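{- The smallest number of vertices of a finite 4-regular simple graph $G$ which, for every $r \in \{1,2,3,4\}$, has an independent exact $r$-cover, is $210$.
   Context: Let $G$ be a $d$-regular simple graph. For $0 \le r \le d$, an independent exact $r$-cover of $G$ is a subset $S \subseteq V(G)$ such that no edge of $G$ has both endpoints in $S$, and every vertex of $V(G)\setminus S$ is adjacent to exactly $r$ vertices of $S$. -}

module Defs where

open import Data.Nat using (ℕ; _<_)
open import Data.Bool using (Bool; true; false; if_then_else_)
open import Data.Fin using (Fin)
open import Data.Fin.Subset using (Subset; inside; outside; _∈_; _∉_; _∩_; ∣_∣)
open import Data.Vec using (tabulate)
open import Data.Product using (Σ; ∃; _×_)
open import Relation.Binary.PropositionalEquality using (_≡_)
open import Relation.Nullary using (¬_)

record SimpleGraph (n : ℕ) : Set where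
  field
    adj     : Fin n → Fin n → Bool
    symm    : ∀ u v → adj u v ≡ adj v u
    irrefl  : ∀ v → adj v v ≡ false

open SimpleGraph public

nbhd : ∀ {n} → SimpleGraph n → Fin n → Subset n
nbhd G v = tabulate (λ u → if adj G v u then inside else outside)

degree : ∀ {n} → SimpleGraph n → Fin n → ℕ
degree G v = ∣ nbhd G v ∣

IsRegular : ∀ {n} → SimpleGraph n → ℕ → Set
IsRegular G d = ∀ v → degree G v ≡ d

IsIndependent : ∀ {n} → SimpleGraph n → Subset n → Set
IsIndependent G S = ∀ u v → u ∈ S → v ∈ S → adj G u v ≡ false

IsIndepExactCover : ∀ {n} → SimpleGraph n → ℕ → Subset n → Set
IsIndepExactCover G r S =
  IsIndependent G S × (∀ v → v ∉ S → ∣ nbhd G v ∩ S ∣ ≡ r)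

HasIndepExactCover : ∀ {n} → SimpleGraph n → ℕ → Set
HasIndepExactCover G r = ∃ λ S → IsIndepExactCover G r S

Good : ∀ {n} → SimpleGraph n → Set
Good G = IsRegular G 4
       × HasIndepExactCover G 1 × HasIndepExactCover G 2
       × HasIndepExactCover G 3 × HasIndepExactCover G 4

module Submission where

open import Defs
open import Data.Nat using (ℕ; _<_)
open import Data.Product using (Σ; _×_)
open import Relation.Nullary using (¬_)

open import Data.Nat using (zero; suc; _+_; _*_; _∸_; _%_; _≡ᵇ_; _<ᵇ_; >-nonZero; allUpTo?)
open import Data.Nat.Properties as ℕ
  using ( +-*-semiring; +-identityʳ; *-identityʳ; *-comm; *-distribˡ-+; *-distribʳ-+
        ; m∸n+n≡m; <⇒≱; n≮0)
open import Data.Nat.Divisibility using (_∣_; divides; *-cancelʳ-∣; ∣⇒≤)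
open import Data.Nat.Coprimality using (coprime?; coprime-divisor)
open import Data.Nat.LCM using (lcm-least)
open import Data.Bool using (Bool; true; false; _∧_; _∨_; not; if_then_else_)
import Data.Bool.Properties as Bool
open import Data.Fin using (Fin; toℕ)
open import Data.Fin.Properties using (toℕ<n)
open import Data.Fin.Subset using (Subset; _∈_; _∉_; _∩_; _-_; ∁; ∣_∣)
open import Data.Fin.Subset.Properties
  using (x∈p∩q⁺; x∈p⇒∣p-x∣<∣p∣; ∣∁p∣≡n∸∣p∣; ∣p∣≤n)
open import Data.Vec using ([]; _∷_; tabulate; lookup)
open import Data.Vec.Properties
  using (lookup∘tabulate; lookup-zipWith; lookup-map; []=⇒lookup; lookup⇒[]=)
open import Data.Product using (_,_)
open import Function using (_∘_)
open import Relation.Nullary using (Dec; contradiction)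
open import Relation.Nullary.Decidable using (True; from-yes; toWitness)
open import Relation.Binary.PropositionalEquality

open import Algebra.Properties.Semiring.Sum +-*-semiring
  using (sum-syntax; sum-cong-≗; sum-replicate-zero; ∑-comm; *-distribʳ-sum)

-- Double counting the edges between an independent exact r-cover S of a 4-regular graph
-- on n vertices and its complement gives 4∣S∣ = r(n − ∣S∣), so 4 + r divides rn; for
-- r = 1, 2, 3, 4 this makes 5, 3, 7 and 2 divide n, hence 210 ∣ n.
--
-- Conversely, view ℤ/210 as ℤ/2 × ℤ/3 × ℤ/5 × ℤ/7 and join every x to σ₁ x and σ₂ x,
-- which add (1, 1, 1) resp. (1, 1, 2) to the first three coordinates and act on ℤ/7 by
-- the permutations π₇ resp. ρ₇. The four neighbours of x are x ± (1, 1, 1), x ± (1, 1, 2)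
-- in the first three coordinates; they differ from x in the ℤ/2 coordinate and from each
-- other in the ℤ/5 coordinate, so the graph is simple and 4-regular, and each coordinate
-- projection maps neighbourhoods bijectively onto those of a 4-regular multigraph:
-- in ℤ/2 (neighbours x + 1) the set {0} is an exact 4-cover, in ℤ/3 (x ± 1) an exact
-- 2-cover, in ℤ/5 (x ± 1, x ± 2) an exact 1-cover, and π₇, ρ₇ are chosen so that
-- {0, 1, 2} is an exact 3-cover in ℤ/7. The preimages of these sets are the four covers.

χ : Bool → ℕ
χ true  = 1
χ false = 0

∣p∣≡∑χ : ∀ {n} (p : Subset n) → ∣ p ∣ ≡ ∑[ i < n ] χ (lookup p i)
∣p∣≡∑χ []          = refl
∣p∣≡∑χ (true  ∷ p) = cong suc (∣p∣≡∑χ p)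
∣p∣≡∑χ (false ∷ p) = ∣p∣≡∑χ p

x∉p⇒lookup≡false : ∀ {n} {x : Fin n} (p : Subset n) → x ∉ p → lookup p x ≡ false
x∉p⇒lookup≡false {x = x} p x∉p with lookup p x in eq
... | true  = contradiction (lookup⇒[]= x p eq) x∉p
... | false = refl

module _ {n} (G : SimpleGraph n) where

  lookup-nbhd : ∀ v u → lookup (nbhd G v) u ≡ adj G v u
  lookup-nbhd v u = trans (lookup∘tabulate _ u) (if-true-false (adj G v u))
    where
    if-true-false : ∀ b → (if b then true else false) ≡ b
    if-true-false true  = refl
    if-true-false false = refl

  degree≡∑ : ∀ v → degree G v ≡ ∑[ u < n ] χ (adj G v u)
  degree≡∑ v = trans (∣p∣≡∑χ (nbhd G v)) (sum-cong-≗ (cong χ ∘ lookup-nbhd v))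

  ∣nbhd∩p∣≡∑ : ∀ v p → ∣ nbhd G v ∩ p ∣ ≡ ∑[ u < n ] χ (adj G v u ∧ lookup p u)
  ∣nbhd∩p∣≡∑ v p = trans (∣p∣≡∑χ (nbhd G v ∩ p)) (sum-cong-≗ λ u → cong χ (
    trans (lookup-zipWith _∧_ u (nbhd G v) p) (cong (_∧ lookup p u) (lookup-nbhd v u))))

  ∣nbhd∩S∣≡0⇒independent : ∀ S → (∀ v → v ∈ S → ∣ nbhd G v ∩ S ∣ ≡ 0) → IsIndependent G S
  ∣nbhd∩S∣≡0⇒independent S none u v u∈S v∈S with adj G u v in uv
  ... | false = refl
  ... | true  = contradiction ∣N∩S-v∣<0 n≮0
    where
    v∈N∩S : v ∈ nbhd G u ∩ S
    v∈N∩S = x∈p∩q⁺ (lookup⇒[]= v (nbhd G u) (trans (lookup-nbhd u v) uv) , v∈S)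
    ∣N∩S-v∣<0 : ∣ nbhd G u ∩ S - v ∣ < 0
    ∣N∩S-v∣<0 = subst (∣ nbhd G u ∩ S - v ∣ <_) (none u u∈S) (x∈p⇒∣p-x∣<∣p∣ v∈N∩S)

  crossing : Subset n → Fin n → Fin n → ℕ
  crossing S u v = χ (lookup S u ∧ adj G u v ∧ not (lookup S v))

  crossing-rowSum : ∀ {d S} → IsRegular G d → IsIndependent G S →
                    ∀ u → ∑[ v < n ] crossing S u v ≡ χ (lookup S u) * d
  crossing-rowSum {d} {S} regular independent u with lookup S u in su
  ... | false = sum-replicate-zero n
  ... | true  = begin
    ∑[ v < n ] χ (adj G u v ∧ not (lookup S v))  ≡⟨ sum-cong-≗ (cong χ ∘ edge-leaves-S) ⟩
    ∑[ v < n ] χ (adj G u v)                     ≡⟨ degree≡∑ u ⟨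
    degree G u                                   ≡⟨ regular u ⟩
    d                                            ≡⟨ +-identityʳ d ⟨
    d + 0                                        ∎
    where
    open ≡-Reasoning
    edge-leaves-S : ∀ v → adj G u v ∧ not (lookup S v) ≡ adj G u v
    edge-leaves-S v with lookup S v in sv
    ... | true  = trans (Bool.∧-zeroʳ _) (sym (independent u v (lookup⇒[]= u S su) (lookup⇒[]= v S sv)))
    ... | false = Bool.∧-identityʳ _

  crossing-columnSum : ∀ {r S} → (∀ v → v ∉ S → ∣ nbhd G v ∩ S ∣ ≡ r) →
                       ∀ v → ∑[ u < n ] crossing S u v ≡ χ (not (lookup S v)) * r
  crossing-columnSum {r} {S} exact v with lookup S v in sv
  ... | true  = trans (sum-cong-≗ (cong χ ∘ no-edge-into-S)) (sum-replicate-zero n)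
    where
    no-edge-into-S : ∀ u → lookup S u ∧ adj G u v ∧ false ≡ false
    no-edge-into-S u = trans (cong (lookup S u ∧_) (Bool.∧-zeroʳ _)) (Bool.∧-zeroʳ _)
  ... | false = begin
    ∑[ u < n ] χ (lookup S u ∧ adj G u v ∧ true)  ≡⟨ sum-cong-≗ (cong χ ∘ reorder) ⟩
    ∑[ u < n ] χ (adj G v u ∧ lookup S u)         ≡⟨ ∣nbhd∩p∣≡∑ v S ⟨
    ∣ nbhd G v ∩ S ∣                              ≡⟨ exact v v∉S ⟩
    r                                             ≡⟨ +-identityʳ r ⟨
    r + 0                                         ∎
    where
    open ≡-Reasoning
    v∉S : v ∉ S
    v∉S v∈S = contradiction (trans (sym sv) ([]=⇒lookup v∈S)) λ ()
    reorder : ∀ u → lookup S u ∧ adj G u v ∧ true ≡ adj G v u ∧ lookup S u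
    reorder u rewrite Bool.∧-identityʳ (adj G u v) | symm G u v = Bool.∧-comm (lookup S u) _

  exactCover⇒∣S∣*d≡∣∁S∣*r : ∀ {d r S} → IsRegular G d → IsIndepExactCover G r S →
                            ∣ S ∣ * d ≡ ∣ ∁ S ∣ * r
  exactCover⇒∣S∣*d≡∣∁S∣*r {d} {r} {S} regular (independent , exact) = begin
    ∣ S ∣ * d                              ≡⟨ cong (_* d) (∣p∣≡∑χ S) ⟩
    ∑[ u < n ] χ (s u) * d                 ≡⟨ *-distribʳ-sum d (χ ∘ s) ⟩
    ∑[ u < n ] (χ (s u) * d)               ≡⟨ sum-cong-≗ (crossing-rowSum regular independent) ⟨
    ∑[ u < n ] ∑[ v < n ] crossing S u v   ≡⟨ ∑-comm (crossing S) ⟩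
    ∑[ v < n ] ∑[ u < n ] crossing S u v   ≡⟨ sum-cong-≗ (crossing-columnSum exact) ⟩
    ∑[ v < n ] (χ (not (s v)) * r)         ≡⟨ *-distribʳ-sum r (χ ∘ not ∘ s) ⟨
    ∑[ v < n ] χ (not (s v)) * r           ≡⟨ cong (_* r) ∣∁S∣≡∑ ⟨
    ∣ ∁ S ∣ * r                            ∎
    where
    open ≡-Reasoning
    s : Fin n → Bool
    s = lookup S
    ∣∁S∣≡∑ : ∣ ∁ S ∣ ≡ ∑[ v < n ] χ (not (s v))
    ∣∁S∣≡∑ = trans (∣p∣≡∑χ (∁ S)) (sum-cong-≗ λ v → cong χ (lookup-map v not S))

  exactCover⇒d+r∣n*r : ∀ {d r} → IsRegular G d → HasIndepExactCover G r → d + r ∣ n * r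
  exactCover⇒d+r∣n*r {d} {r} regular (S , cover) = divides ∣ S ∣ (begin
    n * r                        ≡⟨ cong (_* r) (m∸n+n≡m (∣p∣≤n S)) ⟨
    (n ∸ ∣ S ∣ + ∣ S ∣) * r      ≡⟨ cong (λ k → (k + ∣ S ∣) * r) (∣∁p∣≡n∸∣p∣ S) ⟨
    (∣ ∁ S ∣ + ∣ S ∣) * r        ≡⟨ *-distribʳ-+ r ∣ ∁ S ∣ ∣ S ∣ ⟩
    ∣ ∁ S ∣ * r + ∣ S ∣ * r      ≡⟨ cong (_+ ∣ S ∣ * r) (exactCover⇒∣S∣*d≡∣∁S∣*r regular cover) ⟨
    ∣ S ∣ * d + ∣ S ∣ * r        ≡⟨ *-distribˡ-+ ∣ S ∣ d r ⟨
    ∣ S ∣ * (d + r)              ∎)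
    where open ≡-Reasoning

good⇒210∣n : ∀ {n} (G : SimpleGraph n) → Good G → 210 ∣ n
good⇒210∣n {n} G (regular , c₁ , c₂ , c₃ , c₄) =
  lcm-least (lcm-least (lcm-least 2∣n 3∣n) 5∣n) 7∣n
  where
  2∣n : 2 ∣ n
  2∣n = *-cancelʳ-∣ {2} 4 (exactCover⇒d+r∣n*r G regular c₄)
  3∣n : 3 ∣ n
  3∣n = *-cancelʳ-∣ {3} 2 (exactCover⇒d+r∣n*r G regular c₂)
  5∣n : 5 ∣ n
  5∣n = subst (5 ∣_) (*-identityʳ n) (exactCover⇒d+r∣n*r G regular c₁)
  7∣n : 7 ∣ n
  7∣n = coprime-divisor (from-yes (coprime? 7 3))
          (subst (7 ∣_) (*-comm n 3) (exactCover⇒d+r∣n*r G regular c₃))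

countBelow : ℕ → (ℕ → Bool) → ℕ
countBelow zero    p = 0
countBelow (suc n) p = χ (p 0) + countBelow n (p ∘ suc)

∑χ∘toℕ≡countBelow : ∀ n (p : ℕ → Bool) → ∑[ i < n ] χ (p (toℕ i)) ≡ countBelow n p
∑χ∘toℕ≡countBelow zero    p = refl
∑χ∘toℕ≡countBelow (suc n) p = cong (χ (p 0) +_) (∑χ∘toℕ≡countBelow n (p ∘ suc))

-- Graphs and vertex sets are given by relations on ℕ rather than on Fin n, so that the
-- finite checks of the construction run on builtin arithmetic.
module _ (n : ℕ) (R : ℕ → ℕ → Bool) where

  DegreeCounts : ℕ → Set
  DegreeCounts d = ∀ {x} → x < n → countBelow n (R x) ≡ d

  ExactCoverCounts : ℕ → (ℕ → Bool) → Set
  ExactCoverCounts r P =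
    ∀ {x} → x < n → countBelow n (λ y → R x y ∧ P y) ≡ (if P x then 0 else r)

  degreeCounts? : ∀ d → Dec (DegreeCounts d)
  degreeCounts? d = allUpTo? (λ x → countBelow n (R x) ℕ.≟ d) n

  exactCoverCounts? : ∀ r P → Dec (ExactCoverCounts r P)
  exactCoverCounts? r P =
    allUpTo? (λ x → countBelow n (λ y → R x y ∧ P y) ℕ.≟ (if P x then 0 else r)) n

  module _ (R-sym : ∀ x y → R x y ≡ R y x) (R-irrefl : ∀ {x} → x < n → R x x ≡ false) where

    graphOf : SimpleGraph n
    graphOf = record
      { adj    = λ u v → R (toℕ u) (toℕ v)
      ; symm   = λ u v → R-sym (toℕ u) (toℕ v)
      ; irrefl = λ v → R-irrefl (toℕ<n v)
      }

    graphOf-regular : ∀ {d} → DegreeCounts d → IsRegular graphOf d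
    graphOf-regular {d} degrees v = begin
      degree graphOf v                   ≡⟨ degree≡∑ graphOf v ⟩
      ∑[ u < n ] χ (R (toℕ v) (toℕ u))   ≡⟨ ∑χ∘toℕ≡countBelow n (R (toℕ v)) ⟩
      countBelow n (R (toℕ v))           ≡⟨ degrees (toℕ<n v) ⟩
      d                                  ∎
      where open ≡-Reasoning

    graphOf-exactCover : ∀ {r} P → ExactCoverCounts r P →
                         IsIndepExactCover graphOf r (tabulate (P ∘ toℕ))
    graphOf-exactCover {r} P counts =
        ∣nbhd∩S∣≡0⇒independent graphOf S
          (λ v v∈S → trans (∣nbhd∩S∣ v) (cong (if_then 0 else r) (∈S v∈S)))
      , λ v v∉S → trans (∣nbhd∩S∣ v) (cong (if_then 0 else r) (∉S v∉S))
      where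
      S : Subset n
      S = tabulate (P ∘ toℕ)
      ∈S : ∀ {v} → v ∈ S → P (toℕ v) ≡ true
      ∈S {v} v∈S = trans (sym (lookup∘tabulate (P ∘ toℕ) v)) ([]=⇒lookup v∈S)
      ∉S : ∀ {v} → v ∉ S → P (toℕ v) ≡ false
      ∉S {v} v∉S = trans (sym (lookup∘tabulate (P ∘ toℕ) v)) (x∉p⇒lookup≡false S v∉S)
      ∣nbhd∩S∣ : ∀ v → ∣ nbhd graphOf v ∩ S ∣ ≡ (if P (toℕ v) then 0 else r)
      ∣nbhd∩S∣ v = begin
        ∣ nbhd graphOf v ∩ S ∣                         ≡⟨ ∣nbhd∩p∣≡∑ graphOf v S ⟩
        ∑[ u < n ] χ (R (toℕ v) (toℕ u) ∧ lookup S u)  ≡⟨ sum-cong-≗ lookup-S ⟩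
        ∑[ u < n ] χ (R (toℕ v) (toℕ u) ∧ P (toℕ u))   ≡⟨ ∑χ∘toℕ≡countBelow n (λ y → R (toℕ v) y ∧ P y) ⟩
        countBelow n (λ y → R (toℕ v) y ∧ P y)         ≡⟨ counts (toℕ<n v) ⟩
        (if P (toℕ v) then 0 else r)                   ∎
        where
        open ≡-Reasoning
        lookup-S : ∀ u → χ (R (toℕ v) (toℕ u) ∧ lookup S u) ≡ χ (R (toℕ v) (toℕ u) ∧ P (toℕ u))
        lookup-S u = cong (λ b → χ (R (toℕ v) (toℕ u) ∧ b)) (lookup∘tabulate (P ∘ toℕ) u)

-- The residue mod 210 that is a, b, c, d modulo 2, 3, 5, 7 (105, 70, 126, 120 are the
-- corresponding idempotents of ℤ/210).
crt : ℕ → ℕ → ℕ → ℕ → ℕ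
crt a b c d = (105 * a + 70 * b + 126 * c + 120 * d) % 210

π₇ ρ₇ : ℕ → ℕ
π₇ 0 = 5
π₇ 1 = 6
π₇ 2 = 3
π₇ 3 = 4
π₇ 4 = 0
π₇ 5 = 1
π₇ _ = 2
ρ₇ 0 = 3
ρ₇ 1 = 4
ρ₇ 2 = 5
ρ₇ 3 = 1
ρ₇ 4 = 2
ρ₇ 5 = 6
ρ₇ _ = 0

σ₁ σ₂ : ℕ → ℕ
σ₁ x = crt (suc (x % 2)) (suc (x % 3)) (suc (x % 5)) (π₇ (x % 7))
σ₂ x = crt (suc (x % 2)) (suc (x % 3)) (2 + x % 5) (ρ₇ (x % 7))

arc : ℕ → ℕ → Bool
arc x y = (y ≡ᵇ σ₁ x) ∨ (y ≡ᵇ σ₂ x)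

linked : ℕ → ℕ → Bool
linked x y = arc x y ∨ arc y x

linked-sym : ∀ x y → linked x y ≡ linked y x
linked-sym x y = Bool.∨-comm (arc x y) (arc y x)

linked-irrefl : ∀ {x} → x < 210 → linked x x ≡ false
linked-irrefl = from-yes (allUpTo? (λ x → linked x x Bool.≟ false) 210)

G₂₁₀ : SimpleGraph 210
G₂₁₀ = graphOf 210 linked linked-sym linked-irrefl

G₂₁₀-regular : IsRegular G₂₁₀ 4
G₂₁₀-regular =
  graphOf-regular 210 linked linked-sym linked-irrefl (from-yes (degreeCounts? 210 linked 4))

G₂₁₀-exactCover : ∀ r P {_ : True (exactCoverCounts? 210 linked r P)} →
                  HasIndepExactCover G₂₁₀ r
G₂₁₀-exactCover r P {counts} =
  _ , graphOf-exactCover 210 linked linked-sym linked-irrefl P (toWitness counts)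

proposition4p2 : Σ (SimpleGraph 210) (λ G → Good G)
                   × ((n : ℕ) → 0 < n → n < 210 → (G : SimpleGraph n) → ¬ Good G)
proposition4p2 =
  ( G₂₁₀
  , G₂₁₀-regular
  , G₂₁₀-exactCover 1 (λ x → x % 5 ≡ᵇ 0)
  , G₂₁₀-exactCover 2 (λ x → x % 3 ≡ᵇ 0)
  , G₂₁₀-exactCover 3 (λ x → x % 7 <ᵇ 3)
  , G₂₁₀-exactCover 4 (λ x → x % 2 ≡ᵇ 0)
  )
  , λ n 0<n n<210 G good → <⇒≱ n<210 (∣⇒≤ {{>-nonZero 0<n}} (good⇒210∣n G good))
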